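{- Let $A$ be a set of actions containing $\tau$ and $(S,\to)$ a labelled transition system with labels from $A$. Then the relation $\simeq_{D_3}$ on $S$ (defined in the context) is an equivalence relation.
   Context: $s\xrightarrow{a}s'$ means $(s,a,s')\in\to$; $s\xrightarrow{(a)}s'$ means "$s\xrightarrow{a}s'$, or ($a=\tau$ and $s=s'$)"; $\twoheadrightarrow$ is the reflexive–transitive closure of $\xrightarrow{\tau}$; $\omega=\{0,1,\dots\}$. For a binary relation $R$ on $S$: (T) if $sRt$ and $s\xrightarrow{a}s'$, then there are $t'',t'$ with $t\twoheadrightarrow t''\xrightarrow{(a)}t'$, $sRt''$ and $s'Rt'$. (D$_3$) if $sRt$ and $(s_k)_{k\in\omega}$ is an infinite sequence with $s=s_0$ and $s_k\xrightarrow{\tau}s_{k+1}$ for all $k$, then there are an infinite sequence $(t_\ell)_{\ell\in\omega}$ and a map $\sigma:\omega\to\omega$ with $t=t_0$, $t_\ell\xrightarrow{\tau}t_{\ell+1}$ and $s_{\sigma(\ell)}Rt_\ell$ for all $\ell$. $s\simeq_{D_3}t$ iff there is a symmetric relation $R$ satisfying (T) and (D$_3$) with $sRt$. -}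

module Defs where

open import Data.Nat using (ℕ; suc)
open import Data.Product using (Σ; ∃; _×_; _,_)
open import Data.Sum using (_⊎_)
open import Relation.Binary.PropositionalEquality using (_≡_)
open import Relation.Binary.Construct.Closure.ReflexiveTransitive using (Star)
open import Relation.Binary.Definitions using (Symmetric)

record LTS : Set₁ where
  field
    A     : Set
    τ     : A
    S     : Set
    _⟶[_]_ : S → A → S → Set

module _ (L : LTS) where
  open LTS L

  _⟶⦅_⦆_ : S → A → S → Set
  s ⟶⦅ a ⦆ s' = (s ⟶[ a ] s') ⊎ ((a ≡ τ) × (s ≡ s'))

  _↠_ : S → S → Set
  _↠_ = Star (λ s s' → s ⟶[ τ ] s')

  CondT : (S → S → Set) → Set
  CondT R = ∀ {s t s'} {a : A} → R s t → s ⟶[ a ] s' →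
    Σ S λ t'' → Σ S λ t' → (t ↠ t'') × (t'' ⟶⦅ a ⦆ t') × R s t'' × R s' t'

  CondD₃ : (S → S → Set) → Set
  CondD₃ R = ∀ {s t} → R s t → (ss : ℕ → S) → ss 0 ≡ s →
    (∀ k → ss k ⟶[ τ ] ss (suc k)) →
    Σ (ℕ → S) λ ts → Σ (ℕ → ℕ) λ σ →
      (ts 0 ≡ t) × (∀ ℓ → ts ℓ ⟶[ τ ] ts (suc ℓ)) × (∀ ℓ → R (ss (σ ℓ)) (ts ℓ))

  _≃D₃_ : S → S → Set₁
  s ≃D₃ t = Σ (S → S → Set) λ R → Symmetric R × CondT R × CondD₃ R × R s t

module Submission where

open import Defs
open import Data.Product using (Σ; _×_; _,_)
open import Data.Sum using (inj₁; inj₂)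
open import Relation.Binary.PropositionalEquality using (_≡_; refl; sym)
open import Relation.Binary.Construct.Closure.ReflexiveTransitive using (ε; _◅_; _◅◅_)
open import Relation.Binary.Construct.Union using (_∪_)
open import Relation.Binary.Definitions using (Symmetric)
open import Relation.Binary.Structures using (IsEquivalence)

-- The identity relation witnesses reflexivity and swapping witnesses symmetry.
-- For transitivity, a state related through an intermediate one is simulated
-- in two stages: (T) first along the τ-path produced by the left witness, then
-- along its final step; for (D₃) the two index maps compose. The composite
-- R ⨾ R′ is not symmetric, so the witness is R ⨾ R′ ∪ R′ ⨾ R.

module _ (L : LTS) where
  open LTS L

  private
    Relation : Set₁
    Relation = S → S → Set

  _⨾_ : Relation → Relation → Relation
  (R ⨾ R′) s u = Σ S λ t → R s t × R′ t u

  ⟶⦅τ⦆⇒↠ : ∀ {s s′} → _⟶⦅_⦆_ L s τ s′ → _↠_ L s s′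
  ⟶⦅τ⦆⇒↠ (inj₁ step)        = step ◅ ε
  ⟶⦅τ⦆⇒↠ (inj₂ (_ , refl)) = ε

  CondT⇒↠-simulation : ∀ {R : Relation} → CondT L R →
    ∀ {t t′ u} → R t u → _↠_ L t t′ → Σ S λ u′ → _↠_ L u u′ × R t′ u′
  CondT⇒↠-simulation T {u = u} tRu ε = u , ε , tRu
  CondT⇒↠-simulation T tRu (step ◅ steps)
    with T tRu step
  ... | _ , _ , u↠ , u⟶ , _ , tRu′
    with CondT⇒↠-simulation T tRu′ steps
  ... | u′ , u′↠ , t′Ru′ = u′ , u↠ ◅◅ ⟶⦅τ⦆⇒↠ u⟶ ◅◅ u′↠ , t′Ru′

  ≡-CondT : CondT L _≡_
  ≡-CondT {s' = s′} refl step = _ , s′ , ε , inj₁ step , refl , refl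

  ≡-CondD₃ : CondD₃ L _≡_
  ≡-CondD₃ refl ss ss₀ steps = ss , (λ ℓ → ℓ) , ss₀ , steps , λ _ → refl

  ⨾-CondT : ∀ {R R′ : Relation} → CondT L R → CondT L R′ → CondT L (R ⨾ R′)
  ⨾-CondT T T′ (t , sRt , tR′u) step
    with T sRt step
  ... | t″ , t′ , t↠ , t⟶ , sRt″ , s′Rt′
    with CondT⇒↠-simulation T′ tR′u t↠
  ⨾-CondT T T′ (t , sRt , tR′u) step
      | t″ , t′ , t↠ , inj₂ (a≡τ , refl) , sRt″ , s′Rt′
      | u″ , u↠ , t″R′u″ =
    u″ , u″ , u↠ , inj₂ (a≡τ , refl) , (t″ , sRt″ , t″R′u″) , (t″ , s′Rt′ , t″R′u″)
  ⨾-CondT T T′ (t , sRt , tR′u) step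
      | t″ , t′ , t↠ , inj₁ t″⟶ , sRt″ , s′Rt′
      | u″ , u↠ , t″R′u″
    with T′ t″R′u″ t″⟶
  ... | v″ , v′ , u″↠ , v⟶ , t″R′v″ , t′R′v′ =
    v″ , v′ , u↠ ◅◅ u″↠ , v⟶ , (t″ , sRt″ , t″R′v″) , (t′ , s′Rt′ , t′R′v′)

  ⨾-CondD₃ : ∀ {R R′ : Relation} → CondD₃ L R → CondD₃ L R′ → CondD₃ L (R ⨾ R′)
  ⨾-CondD₃ D D′ (t , sRt , tR′u) ss ss₀ steps
    with D sRt ss ss₀ steps
  ... | ts , σ , ts₀ , tsteps , ssRts
    with D′ tR′u ts ts₀ tsteps
  ... | us , σ′ , us₀ , usteps , tsR′us =
    us , (λ ℓ → σ (σ′ ℓ)) , us₀ , usteps , λ ℓ → ts (σ′ ℓ) , ssRts (σ′ ℓ) , tsR′us ℓ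

  ∪-CondT : ∀ {R R′ : Relation} → CondT L R → CondT L R′ → CondT L (R ∪ R′)
  ∪-CondT T T′ (inj₁ sRt) step with T sRt step
  ... | t″ , t′ , t↠ , t⟶ , sRt″ , s′Rt′ = t″ , t′ , t↠ , t⟶ , inj₁ sRt″ , inj₁ s′Rt′
  ∪-CondT T T′ (inj₂ sR′t) step with T′ sR′t step
  ... | t″ , t′ , t↠ , t⟶ , sR′t″ , s′R′t′ = t″ , t′ , t↠ , t⟶ , inj₂ sR′t″ , inj₂ s′R′t′

  ∪-CondD₃ : ∀ {R R′ : Relation} → CondD₃ L R → CondD₃ L R′ → CondD₃ L (R ∪ R′)
  ∪-CondD₃ D D′ (inj₁ sRt) ss ss₀ steps with D sRt ss ss₀ steps
  ... | ts , σ , ts₀ , tsteps , ssRts = ts , σ , ts₀ , tsteps , λ ℓ → inj₁ (ssRts ℓ)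
  ∪-CondD₃ D D′ (inj₂ sR′t) ss ss₀ steps with D′ sR′t ss ss₀ steps
  ... | ts , σ , ts₀ , tsteps , ssR′ts = ts , σ , ts₀ , tsteps , λ ℓ → inj₂ (ssR′ts ℓ)

  ⨾-∪-symmetric : ∀ {R R′ : Relation} → Symmetric R → Symmetric R′ →
    Symmetric ((R ⨾ R′) ∪ (R′ ⨾ R))
  ⨾-∪-symmetric sym sym′ (inj₁ (t , sRt , tR′u)) = inj₂ (t , sym′ tR′u , sym sRt)
  ⨾-∪-symmetric sym sym′ (inj₂ (t , sR′t , tRu)) = inj₁ (t , sym tRu , sym′ sR′t)

  ≃D₃-refl : ∀ {s} → _≃D₃_ L s s
  ≃D₃-refl = _≡_ , sym , ≡-CondT , ≡-CondD₃ , refl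

  ≃D₃-sym : ∀ {s t} → _≃D₃_ L s t → _≃D₃_ L t s
  ≃D₃-sym (R , symR , T , D , sRt) = R , symR , T , D , symR sRt

  ≃D₃-trans : ∀ {s t u} → _≃D₃_ L s t → _≃D₃_ L t u → _≃D₃_ L s u
  ≃D₃-trans (R , symR , T , D , sRt) (R′ , symR′ , T′ , D′ , tR′u) =
    (R ⨾ R′) ∪ (R′ ⨾ R) ,
    ⨾-∪-symmetric {R} {R′} symR symR′ ,
    ∪-CondT (⨾-CondT T T′) (⨾-CondT T′ T) ,
    ∪-CondD₃ (⨾-CondD₃ D D′) (⨾-CondD₃ D′ D) ,
    inj₁ (_ , sRt , tR′u)

theorem1 : (L : LTS) → IsEquivalence (_≃D₃_ L)
theorem1 L = record { refl = ≃D₃-refl L ; sym = ≃D₃-sym L ; trans = ≃D₃-trans L }
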